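{- If $w$ is a recurrent infinite pin word, then the pin class $\mathcal{C}_w$ is box-closed, i.e. $\sigma\boxplus\tau\in\mathcal{C}_w$ for all $\sigma,\tau\in\mathcal{C}_w$.
   Context: Gridded permutations: a (gridded) permutation is a finite set of points in $\mathbb{R}^2$, no two sharing an $x$- or $y$-coordinate and none on the axes, regarded as equal to another if there is a bijection preserving relative horizontal order, relative vertical order and the quadrant of every point (quadrants 1,2,3,4 are top-right, top-left, bottom-left, bottom-right). $\sigma\le\pi$ if some subset of the points of $\pi$ equals $\sigma$. Pin words: over the alphabet $\{\mathsf{l}_\mathsf{u},\mathsf{l}_\mathsf{d},\mathsf{r}_\mathsf{u},\mathsf{r}_\mathsf{d},\mathsf{u}_\mathsf{l},\mathsf{u}_\mathsf{r},\mathsf{d}_\mathsf{l},\mathsf{d}_\mathsf{r}\}$, a pin word is a word in which each letter $x_y$ that is followed by a letter is followed by some $z_x$ with $z$ perpendicular to $x$. Quadrant of a letter: $\{\mathsf{r},\mathsf{u}\}\mapsto1$, $\{\mathsf{l},\mathsf{u}\}\mapsto2$, $\{\mathsf{l},\mathsf{d}\}\mapsto3$, $\{\mathsf{r},\mathsf{d}\}\mapsto4$. A pin word $w=w_1w_2\cdots$ determines $\pi_w$ with points $p_1,p_2,\ldots$: $p_1$ lies in the quadrant of $w_1$; for $i\ge2$, if $w_i=x_y$ then $p_i$ lies outside the smallest axis-parallel rectangle containing the origin and $p_1,\dots,p_{i-1}$ on its side in direction $x$, and lies horizontally or vertically strictly between $p_{i-1}$ and the smallest axis-parallel rectangle containing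 the origin and $p_1,\dots,p_{i-2}$. $\mathcal{C}_w=\{\sigma\text{ finite}:\sigma\le\pi_w\}$. An infinite word is recurrent if every finite factor (contiguous subword) occurs infinitely often. Box sum: $\sigma\boxplus\tau$ is obtained by placing a copy of $\sigma$ near the origin of $\tau$, so that every point of $\sigma$ has smaller absolute $x$-coordinate and smaller absolute $y$-coordinate than every point of $\tau$, each point keeping its quadrant. -}

module Defs where

open import Data.Nat as ℕ using (ℕ; zero; suc; _≥_)
open import Data.Fin using (Fin; _↑ˡ_; _↑ʳ_)
open import Data.Rational using (ℚ; 0ℚ; _<_; _⊔_; _⊓_; ∣_∣)
open import Data.Product using (Σ; ∃; _×_; proj₁; proj₂)
open import Data.Sum using (_⊎_)
open import Relation.Binary.PropositionalEquality using (_≡_; _≢_)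
open import Function.Bundles using (_⇔_)
open import Function.Definitions using (Injective)

-- Points in the plane (rational coordinates suffice: only relative
-- order and quadrant matter).

Point : Set
Point = ℚ × ℚ

xc yc : Point → ℚ
xc = proj₁
yc = proj₂

-- A (finite or infinite) family of points indexed by A is a gridded
-- permutation when no point is on an axis and no two points share an
-- x- or y-coordinate.
Valid : {A : Set} → (A → Point) → Set
Valid {A} P =
  (∀ i → (xc (P i) ≢ 0ℚ) × (yc (P i) ≢ 0ℚ)) ×
  (∀ i j → i ≢ j → (xc (P i) ≢ xc (P j)) × (yc (P i) ≢ yc (P j)))

SameQuad : Point → Point → Set
SameQuad p q = ((0ℚ < xc p) ⇔ (0ℚ < xc q)) × ((0ℚ < yc p) ⇔ (0ℚ < yc q))

SameOrder : Point → Point → Point → Point → Set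
SameOrder p q p′ q′ =
  ((xc p < xc q) ⇔ (xc p′ < xc q′)) × ((yc p < yc q) ⇔ (yc p′ < yc q′))

Contains : {A : Set} → (A → Point) → {n : ℕ} → (Fin n → Point) → Set
Contains {A} P {n} σ =
  Σ (Fin n → A) λ f →
    Injective _≡_ _≡_ f ×
    (∀ i → SameQuad (σ i) (P (f i))) ×
    (∀ i j → SameOrder (σ i) (σ j) (P (f i)) (P (f j)))

-- ρ is (a representative of) σ ⊞ τ : the first n points of ρ form a copy
-- of σ, the last m a copy of τ (quadrants kept), and every point of the σ
-- part has smaller |x| and smaller |y| than every point of the τ part.
IsBoxSum : {n m : ℕ} → (Fin n → Point) → (Fin m → Point) →
           (Fin (n ℕ.+ m) → Point) → Set
IsBoxSum {n} {m} σ τ ρ =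
  (∀ i → SameQuad (σ i) (ρ (i ↑ˡ m))) ×
  (∀ i j → SameOrder (σ i) (σ j) (ρ (i ↑ˡ m)) (ρ (j ↑ˡ m))) ×
  (∀ i → SameQuad (τ i) (ρ (n ↑ʳ i))) ×
  (∀ i j → SameOrder (τ i) (τ j) (ρ (n ↑ʳ i)) (ρ (n ↑ʳ j))) ×
  (∀ i j → (∣ xc (ρ (i ↑ˡ m)) ∣ < ∣ xc (ρ (n ↑ʳ j)) ∣) ×
           (∣ yc (ρ (i ↑ˡ m)) ∣ < ∣ yc (ρ (n ↑ʳ j)) ∣))

data Dir : Set where
  l r u d : Dir

-- the letter xy stands for x_y (x, y perpendicular)
data Letter : Set where
  lu ld ru rd ul ur dl dr : Letter

main sub : Letter → Dir
main lu = l
main ld = l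
main ru = r
main rd = r
main ul = u
main ur = u
main dl = d
main dr = d
sub lu = u
sub ld = d
sub ru = u
sub rd = d
sub ul = l
sub ur = r
sub dl = l
sub dr = r

data Quadrant : Set where
  Q1 Q2 Q3 Q4 : Quadrant

quadrant : Letter → Quadrant
quadrant lu = Q2
quadrant ld = Q3
quadrant ru = Q1
quadrant rd = Q4
quadrant ul = Q2
quadrant ur = Q1
quadrant dl = Q3
quadrant dr = Q4

InQuadrant : Quadrant → Point → Set
InQuadrant Q1 p = (0ℚ < xc p) × (0ℚ < yc p)
InQuadrant Q2 p = (xc p < 0ℚ) × (0ℚ < yc p)
InQuadrant Q3 p = (xc p < 0ℚ) × (yc p < 0ℚ)
InQuadrant Q4 p = (0ℚ < xc p) × (yc p < 0ℚ)

-- infinite words (indexed from 0: w 0 is the paper's w₁)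
Word : Set
Word = ℕ → Letter

IsPinWord : Word → Set
IsPinWord w = ∀ i → sub (w (suc i)) ≡ main (w i)

Recurrent : Word → Set
Recurrent w = ∀ i k N → ∃ λ j → (j ≥ N) × (∀ t → t ℕ.< k → w (j ℕ.+ t) ≡ w (i ℕ.+ t))

maxX minX maxY minY : (ℕ → Point) → ℕ → ℚ
maxX P zero = 0ℚ
maxX P (suc k) = maxX P k ⊔ xc (P k)
minX P zero = 0ℚ
minX P (suc k) = minX P k ⊓ xc (P k)
maxY P zero = 0ℚ
maxY P (suc k) = maxY P k ⊔ yc (P k)
minY P zero = 0ℚ
minY P (suc k) = minY P k ⊓ yc (P k)

Outside : Dir → (ℕ → Point) → ℕ → Point → Set
Outside r P k p = maxX P k < xc p
Outside l P k p = xc p < minX P k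
Outside u P k p = maxY P k < yc p
Outside d P k p = yc p < minY P k

-- p lies (vertically if x is horizontal, horizontally if x is vertical)
-- strictly between P k and the rectangle of P 0 … P (k-1)
Between : Dir → (ℕ → Point) → ℕ → Point → Set
Between r P k p = ((maxY P k < yc p) × (yc p < yc (P k))) ⊎ ((yc (P k) < yc p) × (yc p < minY P k))
Between l P k p = ((maxY P k < yc p) × (yc p < yc (P k))) ⊎ ((yc (P k) < yc p) × (yc p < minY P k))
Between u P k p = ((maxX P k < xc p) × (xc p < xc (P k))) ⊎ ((xc (P k) < xc p) × (xc p < minX P k))
Between d P k p = ((maxX P k < xc p) × (xc p < xc (P k))) ⊎ ((xc (P k) < xc p) × (xc p < minX P k))

-- P : ℕ → Point is a realisation of π_w (P i is the paper's p_{i+1})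
Realizes : Word → (ℕ → Point) → Set
Realizes w P =
  Valid P ×
  InQuadrant (quadrant (w 0)) (P 0) ×
  (∀ i → Outside (main (w (suc i))) P (suc i) (P (suc i)) ×
         Between (main (w (suc i))) P i (P (suc i)))

-- σ ∈ C_w, with π_w represented by a realisation P
InClass : (ℕ → Point) → {n : ℕ} → (Fin n → Point) → Set
InClass P σ = Valid σ × Contains P σ

-- Whether p_b lies above/below or left/right of an earlier pin p_a is decided by the letter
-- w_b alone together with whether b = a + 1: p_b is beyond the whole bounding box of its
-- predecessors in direction main w_b, and beyond that of p_1 … p_{b-2} in direction sub w_b.
-- Take embeddings of σ and τ into π_w. By recurrence, the prefix of w spanning the copy of τ
-- occurs again at some position j beyond all of σ's pins; shifting τ's pins by j preserves
-- their quadrants and relative order. Each shifted pin p_b comes more than one step after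
-- every pin of σ, so it lies beyond them in both directions main w_b and sub w_b, i.e. on the
-- side of its own quadrant — exactly where a point of τ sits relative to σ in σ ⊞ τ.
module Submission where

open import Defs
open import Data.Nat using (ℕ; _+_)
open import Data.Fin using (Fin)

open import Data.Nat as ℕ using (zero; suc; s≤s)
open import Data.Nat.Properties as ℕ
  using (m≤n⇒m<n∨m≡n; n<1+n; m<n⇒m<1+n; +-monoˡ-<; +-cancelʳ-≡; +-comm;
         m≤n+m; m≤m⊔n; m≤n⊔m)
open import Data.Fin as Fin using (_↑ˡ_; _↑ʳ_; splitAt)
open import Data.Fin.Properties using (splitAt-↑ˡ; splitAt-↑ʳ; splitAt⁻¹-↑ˡ; splitAt⁻¹-↑ʳ)
open import Data.Rational using (0ℚ; ∣_∣) renaming (_<_ to _<ℚ_; _≤_ to _≤ℚ_)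
open import Data.Rational.Properties as ℚ
  using (<-trans; <-asym; <-irrefl; ≤-<-trans; <-≤-trans; <⇒≤; ≤-refl; <-cmp;
         neg-antimono-<; 0≤p⇒∣p∣≡p; ∣p∣≡p∨∣p∣≡-p; 0≤∣p∣; ∣-p∣≡∣p∣;
         p≤q⇒p≤q⊔r; p≤q⇒p⊓r≤q; p≤q⊔p; p⊓q≤q)
open import Algebra.Properties.Group ℚ.+-0-group using () renaming (⁻¹-involutive to neg-involutive)
open import Data.Product using (Σ; ∃₂; _×_; _,_; proj₁; proj₂)
open import Data.Sum using (inj₁; inj₂; [_,_]′)
open import Data.Empty using (⊥-elim)
open import Relation.Nullary using (¬_)
open import Relation.Binary.PropositionalEquality
open import Relation.Binary.Definitions using (tri<; tri≈; tri>)
open import Function.Bundles using (_⇔_; mk⇔; Equivalence)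
open import Function.Definitions using (Injective)
open import Function.Properties.Equivalence using () renaming (sym to ⇔-sym; trans to ⇔-trans)

open Equivalence using (to; from)

⇔-of-both : ∀ {A B : Set} → A → B → A ⇔ B
⇔-of-both a b = mk⇔ (λ _ → b) (λ _ → a)

⇔-of-neither : ∀ {A B : Set} → ¬ A → ¬ B → A ⇔ B
⇔-of-neither ¬a ¬b = mk⇔ (λ a → ⊥-elim (¬a a)) (λ b → ⊥-elim (¬b b))

SameQuad-sym : ∀ {p q} → SameQuad p q → SameQuad q p
SameQuad-sym (ex , ey) = ⇔-sym ex , ⇔-sym ey

SameQuad-trans : ∀ {p q s} → SameQuad p q → SameQuad q s → SameQuad p s
SameQuad-trans (ex , ey) (ex′ , ey′) = ⇔-trans ex ex′ , ⇔-trans ey ey′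

SameOrder-sym : ∀ {p q p′ q′} → SameOrder p q p′ q′ → SameOrder p′ q′ p q
SameOrder-sym (ex , ey) = ⇔-sym ex , ⇔-sym ey

SameOrder-trans : ∀ {p q p′ q′ p″ q″} →
  SameOrder p q p′ q′ → SameOrder p′ q′ p″ q″ → SameOrder p q p″ q″
SameOrder-trans (ex , ey) (ex′ , ey′) = ⇔-trans ex ex′ , ⇔-trans ey ey′

SameOrder-diagonal : ∀ p p′ → SameOrder p p p′ p′
SameOrder-diagonal p p′ = ⇔-of-neither (<-irrefl refl) (<-irrefl refl) ,
                           ⇔-of-neither (<-irrefl refl) (<-irrefl refl)

origin : Point
origin = 0ℚ , 0ℚ

Beyond : Dir → Point → Point → Set
Beyond r p q = xc p <ℚ xc q
Beyond l p q = xc q <ℚ xc p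
Beyond u p q = yc p <ℚ yc q
Beyond d p q = yc q <ℚ yc p

Beyond₂ : Dir → Dir → Point → Point → Set
Beyond₂ δ ε p q = Beyond δ p q × Beyond ε p q

opposite : Dir → Dir
opposite r = l
opposite l = r
opposite u = d
opposite d = u

beyond-opposite : ∀ δ {p q} → Beyond δ p q → Beyond (opposite δ) q p
beyond-opposite r b = b
beyond-opposite l b = b
beyond-opposite u b = b
beyond-opposite d b = b

beyond-from-opposite : ∀ δ {p q} → Beyond (opposite δ) p q → Beyond δ q p
beyond-from-opposite r b = b
beyond-from-opposite l b = b
beyond-from-opposite u b = b
beyond-from-opposite d b = b

beyond-trans : ∀ δ {p q s} → Beyond δ p q → Beyond δ q s → Beyond δ p s
beyond-trans r b b′ = <-trans b b′
beyond-trans l b b′ = <-trans b′ b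
beyond-trans u b b′ = <-trans b b′
beyond-trans d b b′ = <-trans b′ b

beyond-irrefl : ∀ δ {p} → ¬ Beyond δ p p
beyond-irrefl r = <-irrefl refl
beyond-irrefl l = <-irrefl refl
beyond-irrefl u = <-irrefl refl
beyond-irrefl d = <-irrefl refl

data Horizontal : Dir → Set where
  hor-r : Horizontal r
  hor-l : Horizontal l

data Vertical : Dir → Set where
  ver-u : Vertical u
  ver-d : Vertical d

data Perpendicular : Dir → Dir → Set where
  hv : ∀ {δ ε} → Horizontal δ → Vertical ε → Perpendicular δ ε
  vh : ∀ {δ ε} → Vertical δ → Horizontal ε → Perpendicular δ ε

horizontal-opposite : ∀ {δ} → Horizontal δ → Horizontal (opposite δ)
horizontal-opposite hor-r = hor-l
horizontal-opposite hor-l = hor-r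

vertical-opposite : ∀ {δ} → Vertical δ → Vertical (opposite δ)
vertical-opposite ver-u = ver-d
vertical-opposite ver-d = ver-u

perpendicular-oppositeʳ : ∀ {δ ε} → Perpendicular δ ε → Perpendicular δ (opposite ε)
perpendicular-oppositeʳ (hv h v) = hv h (vertical-opposite v)
perpendicular-oppositeʳ (vh v h) = vh v (horizontal-opposite h)

perpendicular-opposite : ∀ {δ ε} → Perpendicular δ ε → Perpendicular (opposite δ) (opposite ε)
perpendicular-opposite (hv h v) = hv (horizontal-opposite h) (vertical-opposite v)
perpendicular-opposite (vh v h) = vh (vertical-opposite v) (horizontal-opposite h)

main⊥sub : ∀ L → Perpendicular (main L) (sub L)
main⊥sub lu = hv hor-l ver-u
main⊥sub ld = hv hor-l ver-d
main⊥sub ru = hv hor-r ver-u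
main⊥sub rd = hv hor-r ver-d
main⊥sub ul = vh ver-u hor-l
main⊥sub ur = vh ver-u hor-r
main⊥sub dl = vh ver-d hor-l
main⊥sub dr = vh ver-d hor-r

horizontal-xOrder : ∀ {δ p q p′ q′} → Horizontal δ → Beyond δ p q → Beyond δ p′ q′ →
  (xc p <ℚ xc q) ⇔ (xc p′ <ℚ xc q′)
horizontal-xOrder hor-r b b′ = ⇔-of-both b b′
horizontal-xOrder hor-l b b′ = ⇔-of-neither (<-asym b) (<-asym b′)

vertical-yOrder : ∀ {δ p q p′ q′} → Vertical δ → Beyond δ p q → Beyond δ p′ q′ →
  (yc p <ℚ yc q) ⇔ (yc p′ <ℚ yc q′)
vertical-yOrder ver-u b b′ = ⇔-of-both b b′
vertical-yOrder ver-d b b′ = ⇔-of-neither (<-asym b) (<-asym b′)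

Codirected : Point → Point → Point → Point → Set
Codirected p q p′ q′ =
  ∃₂ λ δ ε → Perpendicular δ ε × Beyond₂ δ ε p q × Beyond₂ δ ε p′ q′

codirected⇒sameOrder : ∀ {p q p′ q′} → Codirected p q p′ q′ → SameOrder p q p′ q′
codirected⇒sameOrder (_ , _ , hv h v , (bδ , bε) , (bδ′ , bε′)) =
  horizontal-xOrder h bδ bδ′ , vertical-yOrder v bε bε′
codirected⇒sameOrder (_ , _ , vh v h , (bδ , bε) , (bδ′ , bε′)) =
  horizontal-xOrder h bε bε′ , vertical-yOrder v bδ bδ′

codirected-swap : ∀ {p q p′ q′} → Codirected p q p′ q′ → Codirected q p q′ p′
codirected-swap (δ , ε , δ⊥ε , (bδ , bε) , (bδ′ , bε′)) =
  opposite δ , opposite ε , perpendicular-opposite δ⊥ε ,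
  (beyond-opposite δ bδ , beyond-opposite ε bε) , (beyond-opposite δ bδ′ , beyond-opposite ε bε′)

inQuadrant⇒beyondOrigin : ∀ L {p} → InQuadrant (quadrant L) p →
  Beyond₂ (main L) (sub L) origin p
inQuadrant⇒beyondOrigin lu (x , y) = x , y
inQuadrant⇒beyondOrigin ld (x , y) = x , y
inQuadrant⇒beyondOrigin ru (x , y) = x , y
inQuadrant⇒beyondOrigin rd (x , y) = x , y
inQuadrant⇒beyondOrigin ul (x , y) = y , x
inQuadrant⇒beyondOrigin ur (x , y) = y , x
inQuadrant⇒beyondOrigin dl (x , y) = y , x
inQuadrant⇒beyondOrigin dr (x , y) = y , x

beyondOrigin⇒inQuadrant : ∀ L {p} → Beyond₂ (main L) (sub L) origin p →
  InQuadrant (quadrant L) p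
beyondOrigin⇒inQuadrant lu (x , y) = x , y
beyondOrigin⇒inQuadrant ld (x , y) = x , y
beyondOrigin⇒inQuadrant ru (x , y) = x , y
beyondOrigin⇒inQuadrant rd (x , y) = x , y
beyondOrigin⇒inQuadrant ul (y , x) = x , y
beyondOrigin⇒inQuadrant ur (y , x) = x , y
beyondOrigin⇒inQuadrant dl (y , x) = x , y
beyondOrigin⇒inQuadrant dr (y , x) = x , y

OffAxes : Point → Set
OffAxes p = (xc p ≢ 0ℚ) × (yc p ≢ 0ℚ)

negative-transfer : ∀ {a b} → (0ℚ <ℚ a) ⇔ (0ℚ <ℚ b) → a ≢ 0ℚ → b <ℚ 0ℚ → a <ℚ 0ℚ
negative-transfer {a} e a≢0 b<0 with <-cmp a 0ℚ
... | tri< a<0 _ _ = a<0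
... | tri≈ _ a≡0 _ = ⊥-elim (a≢0 a≡0)
... | tri> _ _ 0<a = ⊥-elim (<-asym b<0 (to e 0<a))

inQuadrant-transfer : ∀ Q {p q} → SameQuad p q → OffAxes p → InQuadrant Q q → InQuadrant Q p
inQuadrant-transfer Q1 (ex , ey) _         (x , y) = from ex x , from ey y
inQuadrant-transfer Q2 (ex , ey) (x≢0 , _) (x , y) = negative-transfer ex x≢0 x , from ey y
inQuadrant-transfer Q3 (ex , ey) (x≢0 , y≢0) (x , y) =
  negative-transfer ex x≢0 x , negative-transfer ey y≢0 y
inQuadrant-transfer Q4 (ex , ey) (_ , y≢0) (x , y) = from ex x , negative-transfer ey y≢0 y

inQuadrant⇒sameQuad : ∀ Q {p q} → InQuadrant Q p → InQuadrant Q q → SameQuad p q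
inQuadrant⇒sameQuad Q1 (x , y) (x′ , y′) = ⇔-of-both x x′ , ⇔-of-both y y′
inQuadrant⇒sameQuad Q2 (x , y) (x′ , y′) = ⇔-of-neither (<-asym x) (<-asym x′) , ⇔-of-both y y′
inQuadrant⇒sameQuad Q3 (x , y) (x′ , y′) =
  ⇔-of-neither (<-asym x) (<-asym x′) , ⇔-of-neither (<-asym y) (<-asym y′)
inQuadrant⇒sameQuad Q4 (x , y) (x′ , y′) = ⇔-of-both x x′ , ⇔-of-neither (<-asym y) (<-asym y′)

∣p∣<∣q∣⇒p<q : ∀ {p q} → 0ℚ <ℚ q → ∣ p ∣ <ℚ ∣ q ∣ → p <ℚ q
∣p∣<∣q∣⇒p<q {p} {q} 0<q ∣p∣<∣q∣ with ∣p∣≡p∨∣p∣≡-p p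
... | inj₁ ∣p∣≡p = subst₂ _<ℚ_ ∣p∣≡p (0≤p⇒∣p∣≡p (<⇒≤ 0<q)) ∣p∣<∣q∣
... | inj₂ ∣p∣≡-p = ≤-<-trans p≤0 0<q
  where
  p≤0 : p ≤ℚ 0ℚ
  p≤0 = subst (_≤ℚ 0ℚ) (neg-involutive p)
          (ℚ.neg-antimono-≤ (subst (0ℚ ≤ℚ_) ∣p∣≡-p (0≤∣p∣ p)))

∣p∣<∣q∣⇒q<p : ∀ {p q} → q <ℚ 0ℚ → ∣ p ∣ <ℚ ∣ q ∣ → q <ℚ p
∣p∣<∣q∣⇒q<p {p} {q} q<0 ∣p∣<∣q∣ =
  subst₂ _<ℚ_ (neg-involutive q) (neg-involutive p)
    (neg-antimono-< (∣p∣<∣q∣⇒p<q (neg-antimono-< q<0)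
      (subst₂ _<ℚ_ (sym (∣-p∣≡∣p∣ p)) (sym (∣-p∣≡∣p∣ q)) ∣p∣<∣q∣)))

beyond-of-smallerAbs : ∀ δ {s t} → Beyond δ origin t →
  ∣ xc s ∣ <ℚ ∣ xc t ∣ → ∣ yc s ∣ <ℚ ∣ yc t ∣ → Beyond δ s t
beyond-of-smallerAbs r o-t x< y< = ∣p∣<∣q∣⇒p<q o-t x<
beyond-of-smallerAbs l o-t x< y< = ∣p∣<∣q∣⇒q<p o-t x<
beyond-of-smallerAbs u o-t x< y< = ∣p∣<∣q∣⇒p<q o-t y<
beyond-of-smallerAbs d o-t x< y< = ∣p∣<∣q∣⇒q<p o-t y<

beyond₂-of-smallerAbs : ∀ {δ ε s t} → Beyond₂ δ ε origin t →
  ∣ xc s ∣ <ℚ ∣ xc t ∣ → ∣ yc s ∣ <ℚ ∣ yc t ∣ → Beyond₂ δ ε s t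
beyond₂-of-smallerAbs {δ} {ε} (o-δ , o-ε) x< y< =
  beyond-of-smallerAbs δ o-δ x< y< , beyond-of-smallerAbs ε o-ε x< y<

module BoundingBox (P : ℕ → Point) where

  record InBox (k : ℕ) (q : Point) : Set where
    constructor inBox
    field
      ≤maxX : xc q ≤ℚ maxX P k
      minX≤ : minX P k ≤ℚ xc q
      ≤maxY : yc q ≤ℚ maxY P k
      minY≤ : minY P k ≤ℚ yc q

  inBox-suc : ∀ {k q} → InBox k q → InBox (suc k) q
  inBox-suc (inBox x≤ ≤x y≤ ≤y) =
    inBox (p≤q⇒p≤q⊔r _ x≤) (p≤q⇒p⊓r≤q _ ≤x) (p≤q⇒p≤q⊔r _ y≤) (p≤q⇒p⊓r≤q _ ≤y)

  origin-inBox : ∀ k → InBox k origin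
  origin-inBox zero = inBox ≤-refl ≤-refl ≤-refl ≤-refl
  origin-inBox (suc k) = inBox-suc (origin-inBox k)

  earlier-inBox : ∀ {a k} → a ℕ.< k → InBox k (P a)
  earlier-inBox {a} {suc k} (s≤s a≤k) with m≤n⇒m<n∨m≡n a≤k
  ... | inj₁ a<k = inBox-suc (earlier-inBox a<k)
  ... | inj₂ refl =
    inBox (p≤q⊔p (maxX P a) _) (p⊓q≤q (minX P a) _) (p≤q⊔p (maxY P a) _) (p⊓q≤q (minY P a) _)

  outside⇒beyond : ∀ δ {k q p} → InBox k q → Outside δ P k p → Beyond δ q p
  outside⇒beyond r b o = ≤-<-trans (InBox.≤maxX b) o
  outside⇒beyond l b o = <-≤-trans o (InBox.minX≤ b)
  outside⇒beyond u b o = ≤-<-trans (InBox.≤maxY b) o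
  outside⇒beyond d b o = <-≤-trans o (InBox.minY≤ b)

  outside⇒beyondOrigin : ∀ δ {k p} → Outside δ P k p → Beyond δ origin p
  outside⇒beyondOrigin δ {k} = outside⇒beyond δ (origin-inBox k)

  no-return : ∀ δ k p →
    Beyond δ origin (P k) → Beyond δ (P k) p → ¬ Outside (opposite δ) P k p
  no-return δ k p o-Pk Pk-p out = beyond-irrefl δ (beyond-trans δ (beyond-trans δ o-Pk Pk-p)
    (beyond-from-opposite δ {q = p} (outside⇒beyondOrigin (opposite δ) {k} out)))

  -- Of the two alternatives in Between, the one on the far side of the origin from P k is
  -- impossible, since the box contains the origin.
  between-resolve : ∀ L {k p} → Beyond (sub L) origin (P k) → Between (main L) P k p →
    Beyond (opposite (sub L)) (P k) p × Outside (sub L) P k p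
  between-resolve lu s (inj₁ (o , b)) = b , o
  between-resolve lu {k} {p} s (inj₂ (b , o)) = ⊥-elim (no-return u k p s b o)
  between-resolve ld {k} {p} s (inj₁ (o , b)) = ⊥-elim (no-return d k p s b o)
  between-resolve ld s (inj₂ (b , o)) = b , o
  between-resolve ru s (inj₁ (o , b)) = b , o
  between-resolve ru {k} {p} s (inj₂ (b , o)) = ⊥-elim (no-return u k p s b o)
  between-resolve rd {k} {p} s (inj₁ (o , b)) = ⊥-elim (no-return d k p s b o)
  between-resolve rd s (inj₂ (b , o)) = b , o
  between-resolve ul {k} {p} s (inj₁ (o , b)) = ⊥-elim (no-return l k p s b o)
  between-resolve ul s (inj₂ (b , o)) = b , o
  between-resolve ur s (inj₁ (o , b)) = b , o
  between-resolve ur {k} {p} s (inj₂ (b , o)) = ⊥-elim (no-return r k p s b o)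
  between-resolve dl {k} {p} s (inj₁ (o , b)) = ⊥-elim (no-return l k p s b o)
  between-resolve dl s (inj₂ (b , o)) = b , o
  between-resolve dr s (inj₁ (o , b)) = b , o
  between-resolve dr {k} {p} s (inj₂ (b , o)) = ⊥-elim (no-return r k p s b o)

module PinSequence {w : Word} (pw : IsPinWord w) {P : ℕ → Point} (R : Realizes w P) where

  open BoundingBox P

  step-outside : ∀ i → Outside (main (w (suc i))) P (suc i) (P (suc i))
  step-outside i = proj₁ (proj₂ (proj₂ R) i)

  beyondOrigin-main : ∀ i → Beyond (main (w i)) origin (P i)
  beyondOrigin-main zero = proj₁ (inQuadrant⇒beyondOrigin (w 0) (proj₁ (proj₂ R)))
  beyondOrigin-main (suc i) = outside⇒beyondOrigin _ (step-outside i)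

  step-turn : ∀ i → Beyond (opposite (sub (w (suc i)))) (P i) (P (suc i)) ×
                    Outside (sub (w (suc i))) P i (P (suc i))
  step-turn i = between-resolve (w (suc i))
    (subst (λ δ → Beyond δ origin (P i)) (sym (pw i)) (beyondOrigin-main i))
    (proj₂ (proj₂ (proj₂ R) i))

  pin-inQuadrant : ∀ k → InQuadrant (quadrant (w k)) (P k)
  pin-inQuadrant zero = proj₁ (proj₂ R)
  pin-inQuadrant (suc i) = beyondOrigin⇒inQuadrant (w (suc i))
    (beyondOrigin-main (suc i) , outside⇒beyondOrigin _ (proj₂ (step-turn i)))

  adjacent-beyond₂ : ∀ i →
    Beyond₂ (main (w (suc i))) (opposite (sub (w (suc i)))) (P i) (P (suc i))
  adjacent-beyond₂ i = outside⇒beyond _ (earlier-inBox (n<1+n i)) (step-outside i) ,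
                       proj₁ (step-turn i)

  distant-beyond₂ : ∀ {a b} → suc a ℕ.< b → Beyond₂ (main (w b)) (sub (w b)) (P a) (P b)
  distant-beyond₂ {a} {suc i} (s≤s a<i) =
    outside⇒beyond _ (earlier-inBox (m<n⇒m<1+n a<i)) (step-outside i) ,
    outside⇒beyond _ (earlier-inBox a<i) (proj₂ (step-turn i))

  module _ (j : ℕ) where

    shift-sameQuad : ∀ {a} → w (a + j) ≡ w a → SameQuad (P a) (P (a + j))
    shift-sameQuad {a} e = inQuadrant⇒sameQuad _ (pin-inQuadrant a)
      (subst (λ L → InQuadrant (quadrant L) (P (a + j))) e (pin-inQuadrant (a + j)))

    shift-codirected : ∀ {a b} → a ℕ.< b → w (b + j) ≡ w b →
      Codirected (P a) (P b) (P (a + j)) (P (b + j))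
    shift-codirected {a} {suc i} (s≤s a≤i) e with m≤n⇒m<n∨m≡n a≤i
    ... | inj₂ refl =
      _ , _ , perpendicular-oppositeʳ (main⊥sub (w (suc a))) , adjacent-beyond₂ a ,
      subst (λ L → Beyond₂ (main L) (opposite (sub L)) (P (a + j)) (P (suc a + j)))
            e (adjacent-beyond₂ (a + j))
    ... | inj₁ a<i =
      _ , _ , main⊥sub (w (suc i)) , distant-beyond₂ (s≤s a<i) ,
      subst (λ L → Beyond₂ (main L) (sub L) (P (a + j)) (P (suc i + j)))
            e (distant-beyond₂ (s≤s (+-monoˡ-< j a<i)))

    shift-sameOrder : ∀ {a b} → w (a + j) ≡ w a → w (b + j) ≡ w b →
      SameOrder (P a) (P b) (P (a + j)) (P (b + j))
    shift-sameOrder {a} {b} ea eb with ℕ.<-cmp a b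
    ... | tri< a<b _ _ = codirected⇒sameOrder (shift-codirected a<b eb)
    ... | tri≈ _ refl _ = SameOrder-diagonal (P a) (P (a + j))
    ... | tri> _ _ b<a = codirected⇒sameOrder (codirected-swap (shift-codirected b<a ea))

data ↑-View {n m : ℕ} : Fin (n + m) → Set where
  left  : (i : Fin n) → ↑-View (i ↑ˡ m)
  right : (q : Fin m) → ↑-View (n ↑ʳ q)

↑-view : ∀ n {m} (k : Fin (n + m)) → ↑-View k
↑-view n k with splitAt n k in eq
... | inj₁ i = subst ↑-View (splitAt⁻¹-↑ˡ eq) (left i)
... | inj₂ q = subst ↑-View (splitAt⁻¹-↑ʳ eq) (right q)

bounded : ∀ {n} (f : Fin n → ℕ) → Σ ℕ λ K → ∀ i → f i ℕ.≤ K
bounded {zero} f = 0 , λ ()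
bounded {suc n} f with bounded (λ i → f (Fin.suc i))
... | K , f≤K = f Fin.zero ℕ.⊔ K ,
  λ { Fin.zero → m≤m⊔n _ _ ; (Fin.suc i) → ℕ.≤-trans (f≤K i) (m≤n⊔m _ _) }

module BoxSumEmbedding
  {w : Word} (pw : IsPinWord w) {P : ℕ → Point} (R : Realizes w P)
  {n m : ℕ} {σ : Fin n → Point} {τ : Fin m → Point} {ρ : Fin (n + m) → Point}
  (ρ-offAxes : ∀ k → OffAxes (ρ k)) (⊞ : IsBoxSum σ τ ρ)
  (f : Fin n → ℕ) (f-inj : Injective _≡_ _≡_ f)
  (f-quad : ∀ i → SameQuad (σ i) (P (f i)))
  (f-ord : ∀ i i′ → SameOrder (σ i) (σ i′) (P (f i)) (P (f i′)))
  (g : Fin m → ℕ) (g-inj : Injective _≡_ _≡_ g)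
  (g-quad : ∀ q → SameQuad (τ q) (P (g q)))
  (g-ord : ∀ q q′ → SameOrder (τ q) (τ q′) (P (g q)) (P (g q′)))
  (j : ℕ) (g-shifted-far : ∀ i q → suc (f i) ℕ.< g q + j)
  (g-shift-agrees : ∀ q → w (g q + j) ≡ w (g q)) where

  open PinSequence pw R

  σ-quad : ∀ i → SameQuad (σ i) (ρ (i ↑ˡ m))
  σ-quad = proj₁ ⊞

  σ-ord : ∀ i i′ → SameOrder (σ i) (σ i′) (ρ (i ↑ˡ m)) (ρ (i′ ↑ˡ m))
  σ-ord = proj₁ (proj₂ ⊞)

  τ-quad : ∀ q → SameQuad (τ q) (ρ (n ↑ʳ q))
  τ-quad = proj₁ (proj₂ (proj₂ ⊞))

  τ-ord : ∀ q q′ → SameOrder (τ q) (τ q′) (ρ (n ↑ʳ q)) (ρ (n ↑ʳ q′))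
  τ-ord = proj₁ (proj₂ (proj₂ (proj₂ ⊞)))

  σ-inside-τ : ∀ i q → (∣ xc (ρ (i ↑ˡ m)) ∣ <ℚ ∣ xc (ρ (n ↑ʳ q)) ∣) ×
                       (∣ yc (ρ (i ↑ˡ m)) ∣ <ℚ ∣ yc (ρ (n ↑ʳ q)) ∣)
  σ-inside-τ = proj₂ (proj₂ (proj₂ (proj₂ ⊞)))

  embed : Fin (n + m) → ℕ
  embed k = [ f , (λ q → g q + j) ]′ (splitAt n k)

  embed-↑ˡ : ∀ i → embed (i ↑ˡ m) ≡ f i
  embed-↑ˡ i = cong [ f , (λ q → g q + j) ]′ (splitAt-↑ˡ n i m)

  embed-↑ʳ : ∀ q → embed (n ↑ʳ q) ≡ g q + j
  embed-↑ʳ q = cong [ f , (λ q → g q + j) ]′ (splitAt-↑ʳ n m q)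

  σ-before-τ : ∀ i q → f i ≢ g q + j
  σ-before-τ i q e = ℕ.<-irrefl e (ℕ.<-trans (n<1+n (f i)) (g-shifted-far i q))

  embed-inj : Injective _≡_ _≡_ embed
  embed-inj {k} {k′} e with ↑-view n k | ↑-view n k′
  ... | left i | left i′ =
    cong (_↑ˡ m) (f-inj (trans (sym (embed-↑ˡ i)) (trans e (embed-↑ˡ i′))))
  ... | right q | right q′ =
    cong (n ↑ʳ_) (g-inj (+-cancelʳ-≡ _ _ _ (trans (sym (embed-↑ʳ q)) (trans e (embed-↑ʳ q′)))))
  ... | left i | right q =
    ⊥-elim (σ-before-τ i q (trans (sym (embed-↑ˡ i)) (trans e (embed-↑ʳ q))))
  ... | right q | left i =
    ⊥-elim (σ-before-τ i q (trans (sym (embed-↑ˡ i)) (trans (sym e) (embed-↑ʳ q))))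

  τ-shifted-quad : ∀ q → SameQuad (ρ (n ↑ʳ q)) (P (g q + j))
  τ-shifted-quad q = SameQuad-trans (SameQuad-trans (SameQuad-sym (τ-quad q)) (g-quad q))
                                    (shift-sameQuad j (g-shift-agrees q))

  embed-quad : ∀ k → SameQuad (ρ k) (P (embed k))
  embed-quad k with ↑-view n k
  ... | left i rewrite embed-↑ˡ i = SameQuad-trans (SameQuad-sym (σ-quad i)) (f-quad i)
  ... | right q rewrite embed-↑ʳ q = τ-shifted-quad q

  τ-beyond₂-σ : ∀ i q →
    Beyond₂ (main (w (g q + j))) (sub (w (g q + j))) (ρ (i ↑ˡ m)) (ρ (n ↑ʳ q))
  τ-beyond₂-σ i q =
    beyond₂-of-smallerAbs τ-beyondOrigin (proj₁ (σ-inside-τ i q)) (proj₂ (σ-inside-τ i q))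
    where
    τ-beyondOrigin : Beyond₂ (main (w (g q + j))) (sub (w (g q + j))) origin (ρ (n ↑ʳ q))
    τ-beyondOrigin = inQuadrant⇒beyondOrigin (w (g q + j))
      (inQuadrant-transfer _ (τ-shifted-quad q) (ρ-offAxes (n ↑ʳ q)) (pin-inQuadrant (g q + j)))

  σ-τ-codirected : ∀ i q → Codirected (ρ (i ↑ˡ m)) (ρ (n ↑ʳ q)) (P (f i)) (P (g q + j))
  σ-τ-codirected i q =
    _ , _ , main⊥sub (w (g q + j)) , τ-beyond₂-σ i q , distant-beyond₂ (g-shifted-far i q)

  embed-ord : ∀ k k′ → SameOrder (ρ k) (ρ k′) (P (embed k)) (P (embed k′))
  embed-ord k k′ with ↑-view n k | ↑-view n k′
  ... | left i | left i′ rewrite embed-↑ˡ i | embed-↑ˡ i′ =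
    SameOrder-trans (SameOrder-sym (σ-ord i i′)) (f-ord i i′)
  ... | right q | right q′ rewrite embed-↑ʳ q | embed-↑ʳ q′ =
    SameOrder-trans (SameOrder-trans (SameOrder-sym (τ-ord q q′)) (g-ord q q′))
                    (shift-sameOrder j (g-shift-agrees q) (g-shift-agrees q′))
  ... | left i | right q rewrite embed-↑ˡ i | embed-↑ʳ q =
    codirected⇒sameOrder (σ-τ-codirected i q)
  ... | right q | left i rewrite embed-↑ˡ i | embed-↑ʳ q =
    codirected⇒sameOrder (codirected-swap (σ-τ-codirected i q))

  ρ-contained : Contains P ρ
  ρ-contained = embed , embed-inj , embed-quad , embed-ord

proposition3p3 : (w : Word) → IsPinWord w → Recurrent w →
    (P : ℕ → Point) → Realizes w P →
    {n m : ℕ} (σ : Fin n → Point) (τ : Fin m → Point) →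
    InClass P σ → InClass P τ →
    (ρ : Fin (n + m) → Point) → Valid ρ → IsBoxSum σ τ ρ →
    InClass P ρ
proposition3p3 w pw rec P R σ τ (_ , f , f-inj , f-quad , f-ord) (_ , g , g-inj , g-quad , g-ord)
               ρ ρ-valid ⊞
  with bounded f | bounded g
... | K , f≤K | L , g≤L with rec 0 (suc L) (suc (suc K))
... | j , K+2≤j , w-repeats =
  ρ-valid ,
  BoxSumEmbedding.ρ-contained pw R (proj₁ ρ-valid) ⊞ f f-inj f-quad f-ord g g-inj g-quad g-ord
    j g-shifted-far g-shift-agrees
  where
  g-shifted-far : ∀ i q → suc (f i) ℕ.< g q + j
  g-shifted-far i q = ℕ.≤-trans (s≤s (s≤s (f≤K i))) (ℕ.≤-trans K+2≤j (m≤n+m j (g q)))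

  g-shift-agrees : ∀ q → w (g q + j) ≡ w (g q)
  g-shift-agrees q = trans (cong w (+-comm (g q) j)) (w-repeats (g q) (s≤s (g≤L q)))
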